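{- Let $0<\epsilon<1$, $\beta=2+3\epsilon$, $L=2+\lceil\log_{1+\epsilon}n\rceil$, and $\tilde\alpha_j=(1+\epsilon)^{j-1}$ for $j\in[L]$. Let $G=(V,E)$ be an $n$-node graph with arboricity $\alpha$, and let $(Z_{i,j})_{i,j\in[L]}$ be a $(\beta,(2(1+\epsilon)\tilde\alpha_j)_{j\in[L]},L)$-decomposition system of $G$. Then every edge $e\in E$ satisfies $\tilde\alpha_{\mathcal L(e)}<(1+\epsilon)\alpha$.
   Context: A $(\beta,d,L)$-decomposition of $G$ is a sequence of node sets $Z_L\subseteq\dots\subseteq Z_1=V$ such that for every $i\in[L-1]$, every $u\in Z_i$ with $\deg_{G[Z_i]}(u)>\beta d$ lies in $Z_{i+1}$ and no $u\in Z_i$ with $\deg_{G[Z_i]}(u)<d$ lies in $Z_{i+1}$. A $(\beta,(d_j)_{j\in[K]},L)$-decomposition system is a family $(Z_{i,j})_{i\in[L],j\in[K]}$ such that for each $j$ (the layer), $(Z_{i,j})_{i\in[L]}$ is a $(\beta,d_j,L)$-decomposition. The level $\ell_j(u)$ of $u$ in layer $j$ is the $i$ with $u\in Z_{i,j}\setminus Z_{i+1,j}$ (with $Z_{L+1,j}=\varnothing$). The layer of a node is $\mathcal L(u)=\min\{j\in[K]:\ell_j(u)<L\}$, and the layer of an edge $e=(u,v)$ is $\mathcal L(e)=\min\{\mathcal L(u),\mathcal L(v)\}$. The arboricity of $G$ is the smallest integer $\alpha$ with $\lceil|E(G[S])|/(|S|-1)\rceil\le\alpha$ for all $S\subseteq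 V$, $|S|\ge 2$.
   Formalization: The parameter ε is rational, so β, the degree bounds $2(1+\epsilon)\tilde\alpha_j$ and the values $\tilde\alpha_j$ are too. -}

module Defs where

open import Data.Bool using (Bool; true; false; _∧_; if_then_else_)
open import Data.Nat as ℕ using (ℕ; zero; suc; _∸_)
import Data.Nat.DivMod as ℕD
open import Data.Integer using (+_)
open import Data.Fin using (Fin; toℕ)
open import Data.Fin.Subset using (Subset; _∈_; _∉_; _∩_; ∣_∣; ⊤; _⊆_)
open import Data.Vec using (tabulate; lookup)
open import Data.List using (List; map; allFin)
open import Data.Nat.ListAction using (sum)
open import Data.Product using (_×_; ∃; ∃-syntax; _,_)
open import Data.Sum using (_⊎_)
open import Relation.Binary.PropositionalEquality using (_≡_)
open import Data.Rational using (ℚ; _+_; _*_; _<_; _≤_; _/_; 1ℚ)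

ℕ→ℚ : ℕ → ℚ
ℕ→ℚ n = + n / 1

_^_ : ℚ → ℕ → ℚ
x ^ zero  = 1ℚ
x ^ suc k = x * (x ^ k)

ceilDiv : (a b : ℕ) → .{{ℕ.NonZero b}} → ℕ
ceilDiv a b = (a ℕ.+ (b ∸ 1)) ℕD./ b

record Graph (n : ℕ) : Set where
  field
    adj    : Fin n → Fin n → Bool
    sym    : ∀ u v → adj u v ≡ adj v u
    irrefl : ∀ u → adj u u ≡ false
open Graph public

Edge : ∀ {n} → Graph n → Fin n → Fin n → Set
Edge G u v = adj G u v ≡ true

N : ∀ {n} → Graph n → Fin n → Subset n
N G u = tabulate (adj G u)

deg : ∀ {n} → Graph n → Subset n → Fin n → ℕ
deg G Z u = ∣ Z ∩ N G u ∣

mem : ∀ {n} → Fin n → Subset n → Bool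
mem u S = lookup S u

-- |E(G[S])| : number of unordered pairs {u,v} ⊆ S with u adjacent to v
edgesIn : ∀ {n} → Graph n → Subset n → ℕ
edgesIn {n} G S =
  sum (map (λ u → sum (map (λ v →
        if mem u S ∧ mem v S ∧ adj G u v ∧ (toℕ u ℕ.<ᵇ toℕ v) then 1 else 0)
      (allFin n))) (allFin n))

-- α is the arboricity of G: the smallest integer with
-- ⌈|E(G[S])|/(|S|-1)⌉ ≤ α for all S ⊆ V with |S| ≥ 2
ArbBound : ∀ {n} → Graph n → ℕ → Set
-- (|S| ≥ 2 is written |S| = k + 2, so that |S| - 1 = k + 1 is visibly nonzero)
ArbBound G α = ∀ S k → ∣ S ∣ ≡ suc (suc k) →
  ceilDiv (edgesIn G S) (suc k) ℕ.≤ α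

IsArboricity : ∀ {n} → Graph n → ℕ → Set
IsArboricity G α = ArbBound G α × (∀ α′ → ArbBound G α′ → α ℕ.≤ α′)

-- Decompositions (indices are 1-based natural numbers; Z i for i ∈ [L])

IsDecomposition : ∀ {n} → Graph n → ℚ → ℚ → ℕ → (ℕ → Subset n) → Set
IsDecomposition G β d L Z =
  (Z 1 ≡ ⊤)
  × (∀ i → 1 ℕ.≤ i → i ℕ.< L → Z (suc i) ⊆ Z i)
  × (∀ i → 1 ℕ.≤ i → i ℕ.< L → ∀ u → u ∈ Z i →
       β * d < ℕ→ℚ (deg G (Z i) u) → u ∈ Z (suc i))
  × (∀ i → 1 ℕ.≤ i → i ℕ.< L → ∀ u → u ∈ Z i →
       ℕ→ℚ (deg G (Z i) u) < d → u ∉ Z (suc i))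

IsDecompositionSystem : ∀ {n} → Graph n → ℚ → (ℕ → ℚ) → ℕ → ℕ →
                        (ℕ → ℕ → Subset n) → Set
IsDecompositionSystem G β d K L Z =
  ∀ j → 1 ℕ.≤ j → j ℕ.≤ K → IsDecomposition G β (d j) L (λ i → Z i j)

-- ℓ_j(u) = i : u ∈ Z_{i,j} \ Z_{i+1,j}, with Z_{L+1,j} = ∅
IsLevel : ∀ {n} → ℕ → (ℕ → ℕ → Subset n) → ℕ → Fin n → ℕ → Set
IsLevel L Z j u i =
  1 ℕ.≤ i × i ℕ.≤ L × u ∈ Z i j × (i ≡ L ⊎ u ∉ Z (suc i) j)

LevelBelow : ∀ {n} → ℕ → (ℕ → ℕ → Subset n) → ℕ → Fin n → Set
LevelBelow L Z j u = ∃[ i ] (IsLevel L Z j u i × i ℕ.< L)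

IsEdgeLayer : ∀ {n} → ℕ → ℕ → (ℕ → ℕ → Subset n) → Fin n → Fin n → ℕ → Set
IsEdgeLayer K L Z u v j =
  1 ℕ.≤ j × j ℕ.≤ K
  × (LevelBelow L Z j u ⊎ LevelBelow L Z j v)
  × (∀ j′ → 1 ℕ.≤ j′ → j′ ℕ.< j →
       (LevelBelow L Z j′ u ⊎ LevelBelow L Z j′ v) → Data.Empty.⊥)
  where import Data.Empty

-- In a layer j with α ≤ α̃_j every level shrinks by the factor 1 + ε: each node of Z_{i+1,j} has degree
-- at least d_j = 2(1+ε)α̃_j in G[Z_{i,j}], while by the arboricity bound the degrees in G[Z_{i,j}] sum to
-- at most 2α|Z_{i,j}|. As n ≤ (1+ε)^(L-2), the top level Z_{L,j} of such a layer is empty. The edge layer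
-- 𝓛(e) exists because in layer L the threshold d_L exceeds n, and in the layer before it both endpoints
-- stay at level L, so α̃_{𝓛(e)-1} < α and α̃_{𝓛(e)} = (1+ε)α̃_{𝓛(e)-1} < (1+ε)α (for 𝓛(e) = 1 use α ≥ 1,
-- as G has an edge).
module Submission where

open import Defs hiding (sym)
open import Data.Bool using (Bool; true; false; _∧_; if_then_else_)
open import Data.Empty using (⊥; ⊥-elim)
open import Data.Fin using (Fin; zero; suc; toℕ)
open import Data.Fin.Properties using (toℕ-injective)
open import Data.Fin.Subset using (Subset; inside; outside; _∈_; _∉_; _∩_; ∣_∣; ⊤; _⊆_)
open import Data.Fin.Subset.Properties
  using (_∈?_; drop-∷-⊆; ∈⊤; ∣⊤∣≡n; ∣p∣≤n; p⊂q⇒∣p∣<∣q∣; p∩q⊆p; x∈p∩q⁻; x∈p∩q⁺)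
import Data.Integer as ℤ
import Data.Integer.Properties as ℤₚ
open import Data.List using (map; allFin; tabulate)
open import Data.Nat using (ℕ; zero; suc; z≤n; s≤s; _<ᵇ_; _∸_)
import Data.Nat as ℕ
import Data.Nat.Coprimality as Coprime
import Data.Nat.DivMod as ℕ
import Data.Nat.ListAction as List
import Data.Nat.Properties as ℕₚ
open import Algebra.Properties.CommutativeMonoid.Sum ℕₚ.+-0-commutativeMonoid
  using (sum; sum-syntax; sum-cong-≗; sum-replicate-zero; ∑-comm; ∑-distrib-+)
open import Data.Product using (_×_; _,_; proj₁; proj₂; ∃-syntax)
open import Data.Rational using (ℚ; mkℚ; 0ℚ; 1ℚ; _+_; _*_; _≤_; _<_; *≤*; Positive; positive; nonNegative)
open import Data.Rational.Properties
open import Data.Rational.Solver using (module +-*-Solver)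
open import Data.Sum using (_⊎_; inj₁; inj₂) renaming (map to map⊎)
open import Data.Vec using ([]; _∷_; lookup; here; there)
open import Data.Vec.Properties using (lookup-zipWith; lookup∘tabulate; []=⇒lookup; lookup⇒[]=)
open import Function using (_∘_; const)
open import Relation.Binary.PropositionalEquality
open import Relation.Nullary using (¬_; yes; no)
open import Relation.Nullary.Decidable using (¬?; _⊎-dec_)
open import Relation.Unary using (Decidable)

ℕ→ℚ≡mkℚ : ∀ n → ℕ→ℚ n ≡ mkℚ (ℤ.+ n) 0 (Coprime.sym (Coprime.1-coprimeTo n))
ℕ→ℚ≡mkℚ n = normalize-coprime (Coprime.sym (Coprime.1-coprimeTo n))

ℕ→ℚ-+ : ∀ m n → ℕ→ℚ (m ℕ.+ n) ≡ ℕ→ℚ m + ℕ→ℚ n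
ℕ→ℚ-+ m n rewrite ℕ→ℚ≡mkℚ m | ℕ→ℚ≡mkℚ n =
  /-cong (sym (cong₂ ℤ._+_ (ℤₚ.*-identityʳ (ℤ.+ m)) (ℤₚ.*-identityʳ (ℤ.+ n)))) refl

ℕ→ℚ-* : ∀ m n → ℕ→ℚ (m ℕ.* n) ≡ ℕ→ℚ m * ℕ→ℚ n
ℕ→ℚ-* m n rewrite ℕ→ℚ≡mkℚ m | ℕ→ℚ≡mkℚ n = /-cong (ℤₚ.pos-* m n) refl

ℕ→ℚ-mono-≤ : ∀ {m n} → m ℕ.≤ n → ℕ→ℚ m ≤ ℕ→ℚ n
ℕ→ℚ-mono-≤ {m} {n} m≤n rewrite ℕ→ℚ≡mkℚ m | ℕ→ℚ≡mkℚ n =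
  *≤* (ℤₚ.*-monoʳ-≤-nonNeg (ℤ.+ 1) (ℤ.+≤+ m≤n))

ℕ→ℚ-nonNeg : ∀ n → 0ℚ ≤ ℕ→ℚ n
ℕ→ℚ-nonNeg n = ℕ→ℚ-mono-≤ {0} {n} z≤n

χ : Bool → ℕ
χ b = if b then 1 else 0

sum-map-tabulate : ∀ {n} {A : Set} (f : A → ℕ) (g : Fin n → A) →
                   List.sum (map f (tabulate g)) ≡ sum (f ∘ g)
sum-map-tabulate {zero}  f g = refl
sum-map-tabulate {suc n} f g = cong (f (g zero) ℕ.+_) (sum-map-tabulate f (g ∘ suc))

sum-map-allFin : ∀ {n} (f : Fin n → ℕ) → List.sum (map f (allFin n)) ≡ sum f
sum-map-allFin f = sum-map-tabulate f (λ i → i)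

sumOver : ∀ {n} → Subset n → (Fin n → ℕ) → ℕ
sumOver []            f = 0
sumOver (inside  ∷ p) f = f zero ℕ.+ sumOver p (f ∘ suc)
sumOver (outside ∷ p) f = sumOver p (f ∘ suc)

sumOver≡∑ : ∀ {n} (p : Subset n) (f : Fin n → ℕ) →
            sumOver p f ≡ ∑[ i < n ] (if lookup p i then f i else 0)
sumOver≡∑ []            f = refl
sumOver≡∑ (inside  ∷ p) f = cong (f zero ℕ.+_) (sumOver≡∑ p (f ∘ suc))
sumOver≡∑ (outside ∷ p) f = sumOver≡∑ p (f ∘ suc)

∣p∣≡sumOver-1 : ∀ {n} (p : Subset n) → ∣ p ∣ ≡ sumOver p (const 1)
∣p∣≡sumOver-1 []            = refl
∣p∣≡sumOver-1 (inside  ∷ p) = cong suc (∣p∣≡sumOver-1 p)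
∣p∣≡sumOver-1 (outside ∷ p) = ∣p∣≡sumOver-1 p

sumOver-mono-⊆ : ∀ {n} {p q : Subset n} (f : Fin n → ℕ) → p ⊆ q → sumOver p f ℕ.≤ sumOver q f
sumOver-mono-⊆ {p = []}          {[]}          f p⊆q = z≤n
sumOver-mono-⊆ {p = outside ∷ p} {outside ∷ q} f p⊆q = sumOver-mono-⊆ (f ∘ suc) (drop-∷-⊆ p⊆q)
sumOver-mono-⊆ {p = outside ∷ p} {inside  ∷ q} f p⊆q =
  ℕₚ.≤-trans (sumOver-mono-⊆ (f ∘ suc) (drop-∷-⊆ p⊆q)) (ℕₚ.m≤n+m _ (f zero))
sumOver-mono-⊆ {p = inside  ∷ p} {outside ∷ q} f p⊆q with () ← p⊆q here
sumOver-mono-⊆ {p = inside  ∷ p} {inside  ∷ q} f p⊆q =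
  ℕₚ.+-monoʳ-≤ (f zero) (sumOver-mono-⊆ (f ∘ suc) (drop-∷-⊆ p⊆q))

sumOver-≤-∣p∣* : ∀ {n} {p : Subset n} {f : Fin n → ℕ} {c} → (∀ {i} → i ∈ p → f i ℕ.≤ c) →
                 sumOver p f ℕ.≤ ∣ p ∣ ℕ.* c
sumOver-≤-∣p∣* {p = []}          f≤c = z≤n
sumOver-≤-∣p∣* {p = inside  ∷ p} f≤c = ℕₚ.+-mono-≤ (f≤c here) (sumOver-≤-∣p∣* (f≤c ∘ there))
sumOver-≤-∣p∣* {p = outside ∷ p} f≤c = sumOver-≤-∣p∣* (f≤c ∘ there)

∈⇒≤sumOver : ∀ {n} {p : Subset n} (f : Fin n → ℕ) {i} → i ∈ p → f i ℕ.≤ sumOver p f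
∈⇒≤sumOver {p = inside ∷ p} f here        = ℕₚ.m≤m+n (f zero) _
∈⇒≤sumOver {p = inside ∷ p} f (there i∈p) = ℕₚ.≤-trans (∈⇒≤sumOver (f ∘ suc) i∈p) (ℕₚ.m≤n+m _ (f zero))
∈⇒≤sumOver {p = outside ∷ p} f (there i∈p) = ∈⇒≤sumOver (f ∘ suc) i∈p

∈⇒1≤∣p∣ : ∀ {n} {p : Subset n} {i} → i ∈ p → 1 ℕ.≤ ∣ p ∣
∈⇒1≤∣p∣ {p = p} i∈p = ℕₚ.≤-trans (∈⇒≤sumOver (const 1) i∈p) (ℕₚ.≤-reflexive (sym (∣p∣≡sumOver-1 p)))

∣p∣*d≤sumOver : ∀ {n} {p : Subset n} {f : Fin n → ℕ} {d} → (∀ {i} → i ∈ p → d ≤ ℕ→ℚ (f i)) →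
                ℕ→ℚ ∣ p ∣ * d ≤ ℕ→ℚ (sumOver p f)
∣p∣*d≤sumOver {p = []}              {d = d} d≤f = ≤-reflexive (*-zeroˡ d)
∣p∣*d≤sumOver {p = outside ∷ p}             d≤f = ∣p∣*d≤sumOver (d≤f ∘ there)
∣p∣*d≤sumOver {p = inside  ∷ p} {f} {d}     d≤f = begin
  ℕ→ℚ (1 ℕ.+ ∣ p ∣) * d                   ≡⟨ cong (_* d) (ℕ→ℚ-+ 1 ∣ p ∣) ⟩
  (1ℚ + ℕ→ℚ ∣ p ∣) * d                    ≡⟨ *-distribʳ-+ d 1ℚ (ℕ→ℚ ∣ p ∣) ⟩
  1ℚ * d + ℕ→ℚ ∣ p ∣ * d                  ≡⟨ cong (_+ ℕ→ℚ ∣ p ∣ * d) (*-identityˡ d) ⟩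
  d + ℕ→ℚ ∣ p ∣ * d                       ≤⟨ +-mono-≤ (d≤f here) (∣p∣*d≤sumOver (d≤f ∘ there)) ⟩
  ℕ→ℚ (f zero) + ℕ→ℚ (sumOver p (f ∘ suc)) ≡⟨ ℕ→ℚ-+ (f zero) _ ⟨
  ℕ→ℚ (f zero ℕ.+ sumOver p (f ∘ suc))    ∎
  where open ≤-Reasoning

m≤⌈m/n⌉*n : ∀ m n .{{_ : ℕ.NonZero n}} → m ℕ.≤ ceilDiv m n ℕ.* n
m≤⌈m/n⌉*n m n@(suc k) = ℕₚ.+-cancelʳ-≤ k m _ (begin
  m ℕ.+ k                              ≡⟨ ℕ.m≡m%n+[m/n]*n (m ℕ.+ k) n ⟩
  (m ℕ.+ k) ℕ.% n ℕ.+ ceilDiv m n ℕ.* n ≤⟨ ℕₚ.+-monoˡ-≤ _ (ℕₚ.≤-pred (ℕ.m%n<n (m ℕ.+ k) n)) ⟩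
  k ℕ.+ ceilDiv m n ℕ.* n              ≡⟨ ℕₚ.+-comm k _ ⟩
  ceilDiv m n ℕ.* n ℕ.+ k              ∎)
  where open ℕₚ.≤-Reasoning

χ[<ᵇ]+χ[>ᵇ]≡1 : ∀ x y → x ≢ y → χ (x <ᵇ y) ℕ.+ χ (y <ᵇ x) ≡ 1
χ[<ᵇ]+χ[>ᵇ]≡1 zero    zero    x≢y = ⊥-elim (x≢y refl)
χ[<ᵇ]+χ[>ᵇ]≡1 zero    (suc y) _   = refl
χ[<ᵇ]+χ[>ᵇ]≡1 (suc x) zero    _   = refl
χ[<ᵇ]+χ[>ᵇ]≡1 (suc x) (suc y) x≢y = χ[<ᵇ]+χ[>ᵇ]≡1 x y (x≢y ∘ cong suc)

module _ {n} (G : Graph n) where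

  deg≡∑ : ∀ S u → deg G S u ≡ ∑[ v < n ] χ (lookup S v ∧ adj G u v)
  deg≡∑ S u = begin
    ∣ S ∩ N G u ∣                         ≡⟨ ∣p∣≡sumOver-1 (S ∩ N G u) ⟩
    sumOver (S ∩ N G u) (const 1)         ≡⟨ sumOver≡∑ (S ∩ N G u) (const 1) ⟩
    ∑[ v < n ] χ (lookup (S ∩ N G u) v)   ≡⟨ sum-cong-≗ (cong χ ∘ lookup-S∩N) ⟩
    ∑[ v < n ] χ (lookup S v ∧ adj G u v) ∎
    where
    open ≡-Reasoning
    lookup-S∩N : ∀ v → lookup (S ∩ N G u) v ≡ (lookup S v ∧ adj G u v)
    lookup-S∩N v = trans (lookup-zipWith _∧_ v S (N G u)) (cong (lookup S v ∧_) (lookup∘tabulate (adj G u) v))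

  handshake : ∀ S → sumOver S (deg G S) ≡ 2 ℕ.* edgesIn G S
  handshake S = begin
    sumOver S (deg G S)                                           ≡⟨ sumOver≡∑ S (deg G S) ⟩
    ∑[ u < n ] (if lookup S u then deg G S u else 0)              ≡⟨ sum-cong-≗ row ⟩
    ∑[ u < n ] ∑[ v < n ] χ (lookup S u ∧ lookup S v ∧ adj G u v) ≡⟨ sum-cong-≗ (sum-cong-≗ ∘ pair) ⟨
    ∑[ u < n ] ∑[ v < n ] (e u v ℕ.+ e v u)                       ≡⟨ sum-cong-≗ (λ u → ∑-distrib-+ (e u) (λ v → e v u)) ⟩
    ∑[ u < n ] (∑[ v < n ] e u v ℕ.+ ∑[ v < n ] e v u)            ≡⟨ ∑-distrib-+ (λ u → ∑[ v < n ] e u v) _ ⟩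
    E ℕ.+ ∑[ u < n ] ∑[ v < n ] e v u                             ≡⟨ cong (E ℕ.+_) (∑-comm e) ⟨
    E ℕ.+ E                                                       ≡⟨ cong (E ℕ.+_) (ℕₚ.+-identityʳ E) ⟨
    2 ℕ.* E                                                       ≡⟨ cong (2 ℕ.*_) edgesIn≡E ⟨
    2 ℕ.* edgesIn G S                                             ∎
    where
    open ≡-Reasoning
    e : Fin n → Fin n → ℕ
    e u v = χ (lookup S u ∧ lookup S v ∧ adj G u v ∧ (toℕ u <ᵇ toℕ v))
    E = ∑[ u < n ] ∑[ v < n ] e u v

    edgesIn≡E : edgesIn G S ≡ E
    edgesIn≡E = trans (sum-map-allFin (λ u → List.sum (map (e u) (allFin n))))
                      (sum-cong-≗ (sum-map-allFin ∘ e))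

    row : ∀ u → (if lookup S u then deg G S u else 0) ≡ ∑[ v < n ] χ (lookup S u ∧ lookup S v ∧ adj G u v)
    row u with lookup S u
    ... | true  = deg≡∑ S u
    ... | false = sym (sum-replicate-zero n)

    -- the test u < v makes each edge {u,v} of G[S] count exactly once in e u v + e v u
    pair : ∀ u v → e u v ℕ.+ e v u ≡ χ (lookup S u ∧ lookup S v ∧ adj G u v)
    pair u v rewrite Graph.sym G v u with lookup S u | lookup S v | adj G u v in uv
    ... | false | false | _     = refl
    ... | false | true  | false = refl
    ... | false | true  | true  = refl
    ... | true  | false | _     = refl
    ... | true  | true  | false = refl
    ... | true  | true  | true  = χ[<ᵇ]+χ[>ᵇ]≡1 (toℕ u) (toℕ v) u≢v
      where
      u≢v : toℕ u ≢ toℕ v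
      u≢v u≡v with () ← trans (sym uv) (trans (cong (adj G u) (sym (toℕ-injective u≡v))) (Graph.irrefl G u))

  deg<∣S∣ : ∀ {S u} → u ∈ S → deg G S u ℕ.< ∣ S ∣
  deg<∣S∣ {S} {u} u∈S = p⊂q⇒∣p∣<∣q∣ (p∩q⊆p S (N G u) , u , u∈S , u∉S∩N)
    where
    u∉S∩N : u ∉ S ∩ N G u
    u∉S∩N u∈S∩N with () ← trans (sym ([]=⇒lookup (proj₂ (x∈p∩q⁻ S (N G u) u∈S∩N))))
                                 (trans (lookup∘tabulate (adj G u) u) (Graph.irrefl G u))

  edgesIn≡0 : ∀ {S} → ∣ S ∣ ℕ.≤ 1 → edgesIn G S ≡ 0
  edgesIn≡0 {S} ∣S∣≤1 = ℕₚ.n≤0⇒n≡0 (begin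
    edgesIn G S           ≤⟨ ℕₚ.m≤m+n (edgesIn G S) _ ⟩
    2 ℕ.* edgesIn G S     ≡⟨ handshake S ⟨
    sumOver S (deg G S)   ≤⟨ sumOver-≤-∣p∣* {p = S} (λ u∈S → ℕₚ.≤-pred (ℕₚ.≤-trans (deg<∣S∣ u∈S) ∣S∣≤1)) ⟩
    ∣ S ∣ ℕ.* 0           ≡⟨ ℕₚ.*-zeroʳ ∣ S ∣ ⟩
    0                     ∎)
    where open ℕₚ.≤-Reasoning

  edgesIn≤α*[∣S∣∸1] : ∀ {α} → ArbBound G α → ∀ S → edgesIn G S ℕ.≤ α ℕ.* (∣ S ∣ ∸ 1)
  edgesIn≤α*[∣S∣∸1] {α} arb S with ∣ S ∣ in ∣S∣≡
  ... | zero        = ℕₚ.≤-trans (ℕₚ.≤-reflexive (edgesIn≡0 {S} (ℕₚ.≤-trans (ℕₚ.≤-reflexive ∣S∣≡) z≤n))) z≤n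
  ... | suc zero    = ℕₚ.≤-trans (ℕₚ.≤-reflexive (edgesIn≡0 {S} (ℕₚ.≤-reflexive ∣S∣≡))) z≤n
  ... | suc (suc k) = ℕₚ.≤-trans (m≤⌈m/n⌉*n (edgesIn G S) (suc k)) (ℕₚ.*-monoˡ-≤ (suc k) (arb S k ∣S∣≡))

  degreeSum≤2*α*∣S∣ : ∀ {α} → ArbBound G α → ∀ S → sumOver S (deg G S) ℕ.≤ 2 ℕ.* (α ℕ.* ∣ S ∣)
  degreeSum≤2*α*∣S∣ {α} arb S = begin
    sumOver S (deg G S)          ≡⟨ handshake S ⟩
    2 ℕ.* edgesIn G S            ≤⟨ ℕₚ.*-monoʳ-≤ 2 (edgesIn≤α*[∣S∣∸1] arb S) ⟩
    2 ℕ.* (α ℕ.* (∣ S ∣ ∸ 1))    ≤⟨ ℕₚ.*-monoʳ-≤ 2 (ℕₚ.*-monoʳ-≤ α (ℕₚ.m∸n≤m ∣ S ∣ 1)) ⟩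
    2 ℕ.* (α ℕ.* ∣ S ∣)          ∎
    where open ℕₚ.≤-Reasoning

  Edge⇒1≤α : ∀ {α u v} → ArbBound G α → Edge G u v → 1 ℕ.≤ α
  Edge⇒1≤α {α} {u} {v} arb uv = ℕₚ.n≢0⇒n>0 α≢0
    where
    1≤deg : 1 ℕ.≤ deg G ⊤ u
    1≤deg = ∈⇒1≤∣p∣ (x∈p∩q⁺ (∈⊤ , lookup⇒[]= v (N G u) (trans (lookup∘tabulate (adj G u) v) uv)))

    α≢0 : α ≢ 0
    α≢0 refl with () ← ℕₚ.≤-trans (ℕₚ.≤-trans 1≤deg (∈⇒≤sumOver (deg G ⊤) ∈⊤)) (degreeSum≤2*α*∣S∣ arb ⊤)

module _ {q : ℚ} (1<q : 1ℚ < q) where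

  0<q : 0ℚ < q
  0<q = <-trans (positive⁻¹ 1ℚ) 1<q

  0<q^ : ∀ m → 0ℚ < q ^ m
  0<q^ zero    = positive⁻¹ 1ℚ
  0<q^ (suc m) = positive⁻¹ (q * q ^ m) {{pos*pos⇒pos q {{positive 0<q}} (q ^ m) {{positive (0<q^ m)}}}}

  ℕ→ℚ*q≤1⇒≡0 : ∀ c → ℕ→ℚ c * q ≤ 1ℚ → c ≡ 0
  ℕ→ℚ*q≤1⇒≡0 zero    _      = refl
  ℕ→ℚ*q≤1⇒≡0 (suc c) cq≤1 = ⊥-elim (<-irrefl refl (<-≤-trans 1<q q≤1))
    where
    open ≤-Reasoning
    q≤1 : q ≤ 1ℚ
    q≤1 = begin
      q                   ≡⟨ *-identityˡ q ⟨
      1ℚ * q              ≤⟨ *-monoʳ-≤-nonNeg q {{nonNegative (<⇒≤ 0<q)}} (ℕ→ℚ-mono-≤ {1} {suc c} (s≤s z≤n)) ⟩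
      ℕ→ℚ (suc c) * q     ≤⟨ cq≤1 ⟩
      1ℚ                  ∎

  <2*q*[q*_] : ∀ {x} → 0ℚ < x → x < ℕ→ℚ 2 * q * (q * x)
  <2*q*[q*_] {x} 0<x = begin-strict
    x                   ≡⟨ *-identityˡ x ⟨
    1ℚ * x              <⟨ *-monoˡ-<-pos x {{positive 0<x}} 1<q ⟩
    q * x               ≡⟨ *-identityˡ (q * x) ⟨
    1ℚ * (q * x)        <⟨ *-monoˡ-<-pos (q * x) {{pos*pos⇒pos q {{positive 0<q}} x {{positive 0<x}}}} 1<2q ⟩
    ℕ→ℚ 2 * q * (q * x) ∎
    where
    open ≤-Reasoning
    1<2q : 1ℚ < ℕ→ℚ 2 * q
    1<2q = <-≤-trans 1<q (begin
      q                ≡⟨ *-identityˡ q ⟨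
      1ℚ * q           ≤⟨ *-monoʳ-≤-nonNeg q {{nonNegative (<⇒≤ 0<q)}} (ℕ→ℚ-mono-≤ {1} {2} (s≤s z≤n)) ⟩
      ℕ→ℚ 2 * q        ∎)

least-witness : ∀ {P : ℕ → Set} → Decidable P → ∀ {m} → P m →
                ∃[ j ] (j ℕ.≤ m × P j × (∀ {i} → i ℕ.< j → ¬ P i))
least-witness P? {zero}  P0 = 0 , z≤n , P0 , λ ()
least-witness P? {suc m} Pm with P? 0
... | yes P0 = 0 , z≤n , P0 , λ ()
... | no ¬P0 with least-witness (P? ∘ suc) {m} Pm
...   | j , j≤m , Pj , none = suc j , s≤s j≤m , Pj , λ { {zero} _ → ¬P0 ; {suc i} (s≤s i<j) → none i<j }

module Decomposition {n} {G : Graph n} {β d : ℚ} {L : ℕ} {Z : ℕ → Subset n}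
                     (D : IsDecomposition G β d L Z) where

  Z[1]≡⊤ : Z 1 ≡ ⊤
  Z[1]≡⊤ = proj₁ D

  Z[1+i]⊆Z[i] : ∀ {i} → 1 ℕ.≤ i → i ℕ.< L → Z (suc i) ⊆ Z i
  Z[1+i]⊆Z[i] = proj₁ (proj₂ D) _

  lowDegree∉ : ∀ {i u} → 1 ℕ.≤ i → i ℕ.< L → u ∈ Z i → ℕ→ℚ (deg G (Z i) u) < d → u ∉ Z (suc i)
  lowDegree∉ 1≤i i<L = proj₂ (proj₂ (proj₂ D)) _ 1≤i i<L _

  Z[t+i]⊆Z[i] : ∀ t {i} → 1 ℕ.≤ i → t ℕ.+ i ℕ.≤ L → Z (t ℕ.+ i) ⊆ Z i
  Z[t+i]⊆Z[i] zero    _   _      = λ x∈ → x∈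
  Z[t+i]⊆Z[i] (suc t) 1≤i 1+t+i≤L =
    Z[t+i]⊆Z[i] t 1≤i (ℕₚ.<⇒≤ 1+t+i≤L) ∘ Z[1+i]⊆Z[i] (ℕₚ.≤-trans 1≤i (ℕₚ.m≤n+m _ t)) 1+t+i≤L

  Z[L]⊆Z[i] : ∀ {i} → 1 ℕ.≤ i → i ℕ.≤ L → Z L ⊆ Z i
  Z[L]⊆Z[i] {i} 1≤i i≤L = subst (λ m → Z m ⊆ Z i) (ℕₚ.m∸n+n≡m i≤L)
                            (Z[t+i]⊆Z[i] (L ∸ i) 1≤i (ℕₚ.≤-reflexive (ℕₚ.m∸n+n≡m i≤L)))

  ∈Z[1] : ∀ {u} → u ∈ Z 1
  ∈Z[1] {u} = subst (u ∈_) (sym Z[1]≡⊤) ∈⊤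

  ∉Z[2] : 1 ℕ.< L → ℕ→ℚ n < d → ∀ {u} → u ∉ Z 2
  ∉Z[2] 1<L n<d {u} = lowDegree∉ ℕₚ.≤-refl 1<L ∈Z[1] (≤-<-trans (ℕ→ℚ-mono-≤ (∣p∣≤n (Z 1 ∩ N G u))) n<d)

module Levels {n} {G : Graph n} {β d : ℚ} {L : ℕ} {Z : ℕ → ℕ → Subset n} {j : ℕ}
              (D : IsDecomposition G β d L (λ i → Z i j)) where

  open Decomposition {G = G} {β = β} D

  levelBelow⇒∉Z[L] : ∀ {u} → LevelBelow L Z j u → u ∉ Z L j
  levelBelow⇒∉Z[L] (i , (_ , _ , _ , inj₁ i≡L) , i<L)         = ⊥-elim (ℕₚ.<⇒≢ i<L i≡L)
  levelBelow⇒∉Z[L] (i , (_ , _ , _ , inj₂ u∉Z[1+i]) , i<L) = u∉Z[1+i] ∘ Z[L]⊆Z[i] (s≤s z≤n) i<L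

  ∉Z[L]⇒levelBelow : ∀ {u} → 1 ℕ.≤ L → u ∉ Z L j → LevelBelow L Z j u
  ∉Z[L]⇒levelBelow {u} 1≤L u∉Z[L] = climb (L ∸ 1) (ℕₚ.m∸n+n≡m 1≤L) ℕₚ.≤-refl ∈Z[1]
    where
    climb : ∀ t {i} → t ℕ.+ i ≡ L → 1 ℕ.≤ i → u ∈ Z i j → LevelBelow L Z j u
    climb zero    refl _ u∈Z[i] = ⊥-elim (u∉Z[L] u∈Z[i])
    climb (suc t) {i} t+i≡L 1≤i u∈Z[i] with u ∈? Z (suc i) j
    ... | yes u∈Z[1+i] = climb t (trans (ℕₚ.+-suc t i) t+i≡L) (s≤s z≤n) u∈Z[1+i]
    ... | no  u∉Z[1+i] = i , (1≤i , ℕₚ.<⇒≤ i<L , u∈Z[i] , inj₂ u∉Z[1+i]) , i<L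
      where
      i<L : i ℕ.< L
      i<L = subst (i ℕ.<_) t+i≡L (ℕₚ.m<n+m i {suc t} (s≤s z≤n))

module _ {n} {G : Graph n} {β q a : ℚ} {L α : ℕ} {Z : ℕ → Subset n}
         (D : IsDecomposition G β (ℕ→ℚ 2 * q * a) L Z) (arb : ArbBound G α)
         (α≤a : ℕ→ℚ α ≤ a) (0<a : 0ℚ < a) where

  open Decomposition {G = G} {β = β} D

  private
    d = ℕ→ℚ 2 * q * a

  ∣Z[1+i]∣*q≤∣Z[i]∣ : ∀ {i} → 1 ℕ.≤ i → i ℕ.< L → ℕ→ℚ ∣ Z (suc i) ∣ * q ≤ ℕ→ℚ ∣ Z i ∣
  ∣Z[1+i]∣*q≤∣Z[i]∣ {i} 1≤i i<L = *-cancelʳ-≤-pos (ℕ→ℚ 2 * a) {{2a-pos}} (begin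
    ℕ→ℚ ∣ T ∣ * q * (ℕ→ℚ 2 * a)         ≡⟨ reassoc₁ ⟩
    ℕ→ℚ ∣ T ∣ * d                       ≤⟨ ∣p∣*d≤sumOver {p = T} d≤deg ⟩
    ℕ→ℚ (sumOver T (deg G S))           ≤⟨ ℕ→ℚ-mono-≤ degreeSum≤ ⟩
    ℕ→ℚ (2 ℕ.* (α ℕ.* ∣ S ∣))           ≡⟨ trans (ℕ→ℚ-* 2 (α ℕ.* ∣ S ∣)) (cong (ℕ→ℚ 2 *_) (ℕ→ℚ-* α ∣ S ∣)) ⟩
    ℕ→ℚ 2 * (ℕ→ℚ α * ℕ→ℚ ∣ S ∣)         ≤⟨ *-monoˡ-≤-nonNeg (ℕ→ℚ 2) α*∣S∣≤a*∣S∣ ⟩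
    ℕ→ℚ 2 * (a * ℕ→ℚ ∣ S ∣)             ≡⟨ reassoc₂ ⟩
    ℕ→ℚ ∣ S ∣ * (ℕ→ℚ 2 * a)             ∎)
    where
    open ≤-Reasoning
    open +-*-Solver
    S = Z i
    T = Z (suc i)

    T⊆S : T ⊆ S
    T⊆S = Z[1+i]⊆Z[i] 1≤i i<L

    d≤deg : ∀ {w} → w ∈ T → d ≤ ℕ→ℚ (deg G S w)
    d≤deg {w} w∈T = ≮⇒≥ (λ deg<d → lowDegree∉ 1≤i i<L (T⊆S w∈T) deg<d w∈T)

    degreeSum≤ : sumOver T (deg G S) ℕ.≤ 2 ℕ.* (α ℕ.* ∣ S ∣)
    degreeSum≤ = ℕₚ.≤-trans (sumOver-mono-⊆ (deg G S) T⊆S) (degreeSum≤2*α*∣S∣ G arb S)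

    α*∣S∣≤a*∣S∣ : ℕ→ℚ α * ℕ→ℚ ∣ S ∣ ≤ a * ℕ→ℚ ∣ S ∣
    α*∣S∣≤a*∣S∣ = *-monoʳ-≤-nonNeg (ℕ→ℚ ∣ S ∣) {{nonNegative (ℕ→ℚ-nonNeg ∣ S ∣)}} α≤a

    2a-pos : Positive (ℕ→ℚ 2 * a)
    2a-pos = pos*pos⇒pos (ℕ→ℚ 2) a {{positive 0<a}}

    reassoc₁ = solve 4 (λ t q 2′ a → t :* q :* (2′ :* a) := t :* (2′ :* q :* a)) refl (ℕ→ℚ ∣ T ∣) q (ℕ→ℚ 2) a
    reassoc₂ = solve 3 (λ s 2′ a → 2′ :* (a :* s) := s :* (2′ :* a)) refl (ℕ→ℚ ∣ S ∣) (ℕ→ℚ 2) a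

  module _ (1<q : 1ℚ < q) where

    ∣Z[1+i]∣*q^i≤n : ∀ {i} → i ℕ.< L → ℕ→ℚ ∣ Z (suc i) ∣ * q ^ i ≤ ℕ→ℚ n
    ∣Z[1+i]∣*q^i≤n {zero}  _   = ≤-reflexive (trans (*-identityʳ _) (cong ℕ→ℚ (trans (cong ∣_∣ Z[1]≡⊤) (∣⊤∣≡n n))))
    ∣Z[1+i]∣*q^i≤n {suc i} i<L = begin
      ℕ→ℚ ∣ Z (2 ℕ.+ i) ∣ * (q * q ^ i) ≡⟨ *-assoc (ℕ→ℚ ∣ Z (2 ℕ.+ i) ∣) q (q ^ i) ⟨
      ℕ→ℚ ∣ Z (2 ℕ.+ i) ∣ * q * q ^ i   ≤⟨ *-monoʳ-≤-nonNeg (q ^ i) {{nonNegative (<⇒≤ (0<q^ 1<q i))}}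
                                            (∣Z[1+i]∣*q≤∣Z[i]∣ (s≤s z≤n) i<L) ⟩
      ℕ→ℚ ∣ Z (suc i) ∣ * q ^ i         ≤⟨ ∣Z[1+i]∣*q^i≤n (ℕₚ.<⇒≤ i<L) ⟩
      ℕ→ℚ n                             ∎
      where open ≤-Reasoning

    ∉Z[L] : ∀ {k} → L ≡ 2 ℕ.+ k → ℕ→ℚ n ≤ q ^ k → ∀ {u} → u ∉ Z L
    ∉Z[L] {k} refl n≤q^k u∈Z[L] = ℕₚ.<⇒≢ (∈⇒1≤∣p∣ u∈Z[L]) (sym ∣Z[L]∣≡0)
      where
      open ≤-Reasoning
      c = ∣ Z (2 ℕ.+ k) ∣
      ∣Z[L]∣≡0 : c ≡ 0
      ∣Z[L]∣≡0 = ℕ→ℚ*q≤1⇒≡0 1<q c (*-cancelʳ-≤-pos (q ^ k) {{positive (0<q^ 1<q k)}} (begin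
        ℕ→ℚ c * q * q ^ k   ≡⟨ *-assoc (ℕ→ℚ c) q (q ^ k) ⟩
        ℕ→ℚ c * q ^ suc k   ≤⟨ ∣Z[1+i]∣*q^i≤n ℕₚ.≤-refl ⟩
        ℕ→ℚ n               ≤⟨ n≤q^k ⟩
        q ^ k               ≡⟨ *-identityˡ (q ^ k) ⟨
        1ℚ * q ^ k          ∎))

module DecompositionSystem {ε : ℚ} (0<ε : 0ℚ < ε) {n k : ℕ} (n≤q^k : ℕ→ℚ n ≤ (1ℚ + ε) ^ k)
         {G : Graph n} {α : ℕ} (arb : ArbBound G α) {Z : ℕ → ℕ → Subset n}
         (sys : IsDecompositionSystem G (ℕ→ℚ 2 + ℕ→ℚ 3 * ε)
                  (λ j → ℕ→ℚ 2 * (1ℚ + ε) * ((1ℚ + ε) ^ (j ∸ 1))) (2 ℕ.+ k) (2 ℕ.+ k) Z) where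

  private
    q = 1ℚ + ε
    β = ℕ→ℚ 2 + ℕ→ℚ 3 * ε
    L = 2 ℕ.+ k

    1<q : 1ℚ < q
    1<q = subst (_< q) (+-identityʳ 1ℚ) (+-monoʳ-< 1ℚ 0<ε)

    layer : ∀ {m} → m ℕ.< L → IsDecomposition G β (ℕ→ℚ 2 * q * q ^ m) L (λ i → Z i (suc m))
    layer m<L = sys _ (s≤s z≤n) m<L

    module Layer {m} (m<L : m ℕ.< L) where
      open Decomposition {G = G} {β = β} (layer m<L) public
      open Levels {G = G} {β = β} {Z = Z} (layer m<L) public

  ∉Z[L,L] : ∀ {w} → w ∉ Z L L
  ∉Z[L,L] = ∉Z[2] (s≤s (s≤s z≤n)) (≤-<-trans n≤q^k (<2*q*[q*_] 1<q (0<q^ 1<q k)))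
          ∘ Z[L]⊆Z[i] (s≤s z≤n) (s≤s (s≤s z≤n))
    where open Layer ℕₚ.≤-refl

  ∉Z[L,1+m] : ∀ {m} → m ℕ.< L → ℕ→ℚ α ≤ q ^ m → ∀ {w} → w ∉ Z L (suc m)
  ∉Z[L,1+m] {m} m<L α≤q^m = ∉Z[L] {G = G} {β = β} (layer m<L) arb α≤q^m (0<q^ 1<q m) 1<q refl n≤q^k

  module EdgeLayer {u v : Fin n} (uv : Edge G u v) where

    EndpointLeaves : ℕ → Set
    EndpointLeaves j = u ∉ Z L j ⊎ v ∉ Z L j

    endpointLeaves? : Decidable EndpointLeaves
    endpointLeaves? j = ¬? (u ∈? Z L j) ⊎-dec ¬? (v ∈? Z L j)

    endpointLeaves⇒levelBelow : ∀ {m} → m ℕ.< L →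
      EndpointLeaves (suc m) → LevelBelow L Z (suc m) u ⊎ LevelBelow L Z (suc m) v
    endpointLeaves⇒levelBelow m<L =
      map⊎ (Layer.∉Z[L]⇒levelBelow m<L (s≤s z≤n)) (Layer.∉Z[L]⇒levelBelow m<L (s≤s z≤n))

    levelBelow⇒endpointLeaves : ∀ {m} → m ℕ.< L →
      LevelBelow L Z (suc m) u ⊎ LevelBelow L Z (suc m) v → EndpointLeaves (suc m)
    levelBelow⇒endpointLeaves m<L = map⊎ (Layer.levelBelow⇒∉Z[L] m<L) (Layer.levelBelow⇒∉Z[L] m<L)

    -- q α ≤ q^m would give α ≤ α̃_m, so that layer m would already empty its top level
    -- (for m = 0 it would contradict α ≥ 1)
    q^m<q*α : ∀ {m} → m ℕ.< L → (∀ {i} → i ℕ.< m → ¬ EndpointLeaves (suc i)) → q ^ m < q * ℕ→ℚ α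
    q^m<q*α {zero}  _     _    = ≰⇒> λ qα≤1 →
      ℕₚ.<⇒≢ (Edge⇒1≤α G arb uv) (sym (ℕ→ℚ*q≤1⇒≡0 1<q α (subst (_≤ 1ℚ) (*-comm q (ℕ→ℚ α)) qα≤1)))
    q^m<q*α {suc i} 1+i<L none = ≰⇒> λ qα≤q*qⁱ →
      none ℕₚ.≤-refl (inj₁ (∉Z[L,1+m] (ℕₚ.<⇒≤ 1+i<L) (*-cancelˡ-≤-pos q {{positive (0<q 1<q)}} qα≤q*qⁱ)))

corollary4p3 : (ε : ℚ) → 0ℚ < ε → ε < 1ℚ →
    (n : ℕ) →
    (k : ℕ) → ℕ→ℚ n ≤ (1ℚ + ε) ^ k →
    (∀ k′ → ℕ→ℚ n ≤ (1ℚ + ε) ^ k′ → k Data.Nat.≤ k′) →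
    (L : ℕ) → L ≡ 2 Data.Nat.+ k →
    (G : Graph n) → (α : ℕ) → IsArboricity G α →
    (Z : ℕ → ℕ → Subset n) →
    IsDecompositionSystem G (ℕ→ℚ 2 + ℕ→ℚ 3 * ε)
      (λ j → ℕ→ℚ 2 * (1ℚ + ε) * ((1ℚ + ε) ^ (j ∸ 1))) L L Z →
    ∀ (u v : Fin n) → Edge G u v →
    ∃[ j ] (IsEdgeLayer L L Z u v j
            × (1ℚ + ε) ^ (j ∸ 1) < (1ℚ + ε) * ℕ→ℚ α)
corollary4p3 ε 0<ε _ n k n≤q^k _ .(2 ℕ.+ k) refl G α (arb , _) Z sys u v uv =
  firstLayer (least-witness (endpointLeaves? ∘ suc) {suc k} (inj₁ ∉Z[L,L]))
  where
  open DecompositionSystem 0<ε n≤q^k {G = G} arb sys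
  open EdgeLayer uv

  firstLayer : ∃[ m ] (m ℕ.≤ suc k × EndpointLeaves (suc m) × (∀ {i} → i ℕ.< m → ¬ EndpointLeaves (suc i))) →
               ∃[ j ] (IsEdgeLayer (2 ℕ.+ k) (2 ℕ.+ k) Z u v j × (1ℚ + ε) ^ (j ∸ 1) < (1ℚ + ε) * ℕ→ℚ α)
  firstLayer (m , m≤1+k , leaves , none) =
    suc m , (s≤s z≤n , s≤s m≤1+k , endpointLeaves⇒levelBelow (s≤s m≤1+k) leaves , noEarlier) , q^m<q*α (s≤s m≤1+k) none
    where
    noEarlier : ∀ j → 1 ℕ.≤ j → j ℕ.< suc m →
                LevelBelow (2 ℕ.+ k) Z j u ⊎ LevelBelow (2 ℕ.+ k) Z j v → ⊥
    noEarlier (suc i) _ (s≤s i<m) = none i<m ∘ levelBelow⇒endpointLeaves (ℕₚ.<-trans i<m (s≤s m≤1+k))
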